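{- Let $R$ be a dedekind type domain, let $\mathit{M}(R)$ be the monoid generated by the maximal ideals of $R$, and let $\mathcal{I},\mathcal{J}\in\mathit{M}(R)$ be comaximal. Then the map $SL_2(R)\to\mathbb{PF}^1_{\mathcal{I}}\times\mathbb{PF}^1_{\mathcal{J}}$, $\begin{pmatrix}a&b\\c&d\end{pmatrix}\mapsto([a:b],[c:d])$, is surjective.
   Context: Dedekind type domain: a commutative ring $R$ with unity which is a field, or in which every maximal ideal $\mathcal{M}$ satisfies $\mathcal{M}^i\neq\mathcal{M}^{i+1}$ ($i\ge0$), $\bigcap_{i\ge0}\mathcal{M}^i=(0)$, $\dim_{R/\mathcal{M}}\mathcal{M}^i/\mathcal{M}^{i+1}=1$ ($i\ge0$), and every nonzero element lies in only finitely many maximal ideals. $\mathit{M}(R)$ is the set of finite products of maximal ideals ($R$ the empty product). For an ideal $\mathcal{I}$, $\mathbb{PF}^1_{\mathcal{I}}$ is the set of pairs $(a,b)$ with $(a,b)=R$ modulo the equivalence $(a,b)\sim(c,d)\iff ad-bc\in\mathcal{I}$; $[a:b]$ denotes the class. -}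

module Defs where

open import Level using (Level; _⊔_)
open import Algebra.Bundles using (CommutativeRing)
open import Data.Nat using (ℕ; zero; suc)
open import Data.List using (List; []; _∷_)
open import Data.List.Relation.Unary.All using (All)
open import Data.List.Relation.Unary.Any using (Any)
open import Data.Product using (Σ; ∃; ∃-syntax; _×_; _,_)
open import Data.Sum using (_⊎_)
open import Relation.Nullary using (¬_)

module Theory {c ℓ : Level} (R : CommutativeRing c ℓ) where
  open CommutativeRing R

  record Ideal : Set (Level.suc (c ⊔ ℓ)) where
    field
      _∋_      : Carrier → Set (c ⊔ ℓ)
      ∋-resp-≈ : ∀ {x y} → x ≈ y → _∋_ x → _∋_ y
      ∋-0#     : _∋_ 0#
      ∋-+      : ∀ {x y} → _∋_ x → _∋_ y → _∋_ (x + y)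
      ∋-*      : ∀ r {x} → _∋_ x → _∋_ (r * x)
  open Ideal public

  _∈_ : Carrier → Ideal → Set (c ⊔ ℓ)
  x ∈ I = I ∋ x

  _⊆_ : Ideal → Ideal → Set (c ⊔ ℓ)
  I ⊆ J = ∀ x → x ∈ I → x ∈ J

  _≐_ : Ideal → Ideal → Set (c ⊔ ℓ)
  I ≐ J = (I ⊆ J) × (J ⊆ I)

  unitIdeal : Ideal
  unitIdeal = record
    { _∋_ = λ _ → Level.Lift (c ⊔ ℓ) Data.Unit.⊤
    ; ∋-resp-≈ = λ _ _ → Level.lift Data.Unit.tt
    ; ∋-0# = Level.lift Data.Unit.tt
    ; ∋-+ = λ _ _ → Level.lift Data.Unit.tt
    ; ∋-* = λ _ _ → Level.lift Data.Unit.tt }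
    where import Data.Unit

  data ProdMem (I J : Ideal) : Carrier → Set (c ⊔ ℓ) where
    gen  : ∀ {x y} → x ∈ I → y ∈ J → ProdMem I J (x * y)
    zer  : ProdMem I J 0#
    plus : ∀ {x y} → ProdMem I J x → ProdMem I J y → ProdMem I J (x + y)
    scal : ∀ r {x} → ProdMem I J x → ProdMem I J (r * x)
    resp : ∀ {x y} → x ≈ y → ProdMem I J x → ProdMem I J y

  _·_ : Ideal → Ideal → Ideal
  I · J = record
    { _∋_ = ProdMem I J ; ∋-resp-≈ = resp ; ∋-0# = zer ; ∋-+ = plus ; ∋-* = scal }

  _^_ : Ideal → ℕ → Ideal
  M ^ zero  = unitIdeal
  M ^ suc i = (M ^ i) · M

  IsMaximal : Ideal → Set (Level.suc (c ⊔ ℓ))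
  IsMaximal M = ¬ (1# ∈ M) × (∀ (J : Ideal) → M ⊆ J → (J ≐ M) ⊎ (J ≐ unitIdeal))

  record MaximalIdeal : Set (Level.suc (c ⊔ ℓ)) where
    field
      ideal     : Ideal
      isMaximal : IsMaximal ideal
  open MaximalIdeal public

  IsField : Set (c ⊔ ℓ)
  IsField = ¬ (1# ≈ 0#) × (∀ x → ¬ (x ≈ 0#) → ∃[ y ] (x * y ≈ 1#))

  -- dim_{R/M} (M^i / M^{i+1}) = 1 : the quotient has a one-element basis
  -- over the field R/M, i.e. a class t̄ ≠ 0 with every class a scalar multiple of it.
  DimOne : Ideal → ℕ → Set (c ⊔ ℓ)
  DimOne M i = ∃[ t ] (t ∈ (M ^ i) × ¬ (t ∈ (M ^ suc i))
                      × (∀ x → x ∈ (M ^ i) → ∃[ r ] ((x - (r * t)) ∈ (M ^ suc i))))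

  FinitelyManyMaximal : Carrier → Set (Level.suc (c ⊔ ℓ))
  FinitelyManyMaximal x =
    ∃[ Ms ] (∀ (M : MaximalIdeal) → x ∈ ideal M → Any (λ N → ideal M ≐ ideal N) Ms)

  IsDedekindType : Set (Level.suc (c ⊔ ℓ))
  IsDedekindType =
    IsField ⊎
    ( (∀ (M : MaximalIdeal) →
         (∀ i → ¬ ((ideal M ^ i) ≐ (ideal M ^ suc i)))
       × (∀ x → (∀ i → x ∈ (ideal M ^ i)) → x ≈ 0#)
       × (∀ i → DimOne (ideal M) i))
    × (∀ x → ¬ (x ≈ 0#) → FinitelyManyMaximal x))

  prodList : List MaximalIdeal → Ideal
  prodList []       = unitIdeal
  prodList (M ∷ Ms) = ideal M · prodList Ms

  InMR : Ideal → Set (Level.suc (c ⊔ ℓ))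
  InMR I = ∃[ Ms ] (I ≐ prodList Ms)

  Comaximal : Ideal → Ideal → Set (c ⊔ ℓ)
  Comaximal I J = ∃[ i ] ∃[ j ] (i ∈ I × j ∈ J × (i + j ≈ 1#))

  Unimodular : Carrier → Carrier → Set (c ⊔ ℓ)
  Unimodular a b = ∃[ x ] ∃[ y ] (x * a + y * b ≈ 1#)

  PF-equiv : Ideal → (Carrier × Carrier) → (Carrier × Carrier) → Set (c ⊔ ℓ)
  PF-equiv I (a , b) (c' , d) = ((a * d) - (b * c')) ∈ I

  InSL2 : Carrier → Carrier → Carrier → Carrier → Set ℓ
  InSL2 a b c' d = (a * d) - (b * c') ≈ 1#

{-# OPTIONS --safe #-}
-- Let xa + yb = 1, δ = ad - bc and γ = cx + dy. For all q and r the rows (a - qy , b + qx) and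
-- (ra - (1 + rq)y , rb + (1 + rq)x) form a matrix of determinant 1; the first row is equivalent to
-- (a , b) in PF¹_I as soon as q ∈ I, and the second to (c , d) in PF¹_J iff rδ - (1 + rq)γ ∈ J.
-- Taking q = -τi with i ∈ I, i ≡ 1 mod J, and r = γw, this reduces to w(δ + τγ) ≡ 1 mod J.
-- As (δ , γ) is unimodular, such τ and w exist modulo any finite product of maximal ideals
-- (R/J has stable rank one): adding a maximal factor M, either δ + τγ is already a unit mod M, or
-- τ is shifted by a multiple of an element of the previous product that is ≡ 1 mod M.
module Submission where

open import Defs
open import Level using (Level; _⊔_; 0ℓ; lift)
open import Algebra.Bundles using (CommutativeRing)
open import Algebra.Bundles.Raw using (RawRing)
open import Data.Nat as ℕ using (ℕ; zero; suc)
open import Data.Product using (∃-syntax; _×_; _,_; proj₁; proj₂)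
open import Data.Sum as Sum using (_⊎_; inj₁; inj₂)
open import Data.List using ([]; _∷_)
open import Data.Unit using (tt)
open import Data.Empty using (⊥-elim)
open import Data.Maybe using (Maybe; just; nothing)
open import Relation.Binary.PropositionalEquality as ≡ using (_≡_)
open import Relation.Nullary using (yes)
import Algebra.Solver.Ring
import Algebra.Solver.Ring.AlmostCommutativeRing as AlmostCommutativeRing

-- An integer is a pair (m , n) standing for m - n; _⊖_ returns the normal form (m , 0) or
-- (0 , n), so that equal coefficients in the solver's normal forms are syntactically equal.
_⊖_ : ℕ → ℕ → ℕ × ℕ
suc m ⊖ suc n = m ⊖ n
zero  ⊖ n     = zero , n
suc m ⊖ zero  = suc m , zero

ℤ-rawRing : RawRing 0ℓ 0ℓ
ℤ-rawRing = record
  { Carrier = ℕ × ℕ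
  ; _≈_     = _≡_
  ; _+_     = λ { (a , b) (c , d) → (a ℕ.+ c) ⊖ (b ℕ.+ d) }
  ; _*_     = λ { (a , b) (c , d) → (a ℕ.* c ℕ.+ b ℕ.* d) ⊖ (a ℕ.* d ℕ.+ b ℕ.* c) }
  ; -_      = λ { (a , b) → b , a }
  ; 0#      = 0 , 0
  ; 1#      = 1 , 0
  }

module IntegerCoefficientSolver {c ℓ : Level} (R : CommutativeRing c ℓ) where
  open CommutativeRing R hiding (zero)
  open import Algebra.Properties.Semiring.Mult semiring using (×-homo-+; ×1-homo-*) renaming (_×_ to _×ₙ_)
  open import Algebra.Properties.Ring ring using (-‿distribˡ-*; -‿distribʳ-*; -0#≈0#)
  open import Algebra.Properties.AbelianGroup +-abelianGroup using (⁻¹-∙-comm; ⁻¹-anti-homo‿-)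
  open import Algebra.Properties.CommutativeSemigroup +-commutativeSemigroup using (interchange)
  open import Relation.Binary.Reasoning.Setoid setoid

  ι : ℕ → Carrier
  ι n = n ×ₙ 1#

  -- (1 , 0) is sent to 1# itself so that goals may mention 1# literally.
  ⟦_⟧ : ℕ × ℕ → Carrier
  ⟦ 1 , 0 ⟧ = 1#
  ⟦ m , n ⟧ = ι m - ι n

  ⟦⟧-difference : ∀ m n → ⟦ m , n ⟧ ≈ ι m - ι n
  ⟦⟧-difference zero          n       = refl
  ⟦⟧-difference (suc zero)    zero    = sym (begin
    (1# + 0#) - 0#  ≈⟨ +-congˡ -0#≈0# ⟩
    (1# + 0#) + 0#  ≈⟨ +-identityʳ _ ⟩
    1# + 0#         ≈⟨ +-identityʳ 1# ⟩
    1#              ∎)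
  ⟦⟧-difference (suc zero)    (suc n) = refl
  ⟦⟧-difference (suc (suc m)) n       = refl

  −-+-interchange : ∀ x y z w → (x + y) - (z + w) ≈ (x - z) + (y - w)
  −-+-interchange x y z w = trans (+-congˡ (sym (⁻¹-∙-comm z w))) (interchange x y (- z) (- w))

  +-cancelˡ-− : ∀ x y z → (x + y) - (x + z) ≈ y - z
  +-cancelˡ-− x y z = begin
    (x + y) - (x + z)  ≈⟨ −-+-interchange x y x z ⟩
    (x - x) + (y - z)  ≈⟨ +-congʳ (-‿inverseʳ x) ⟩
    0# + (y - z)       ≈⟨ +-identityˡ _ ⟩
    y - z              ∎

  ⟦⊖⟧ : ∀ m n → ⟦ m ⊖ n ⟧ ≈ ι m - ι n
  ⟦⊖⟧ (suc m) (suc n) = trans (⟦⊖⟧ m n) (sym (+-cancelˡ-− 1# (ι m) (ι n)))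
  ⟦⊖⟧ zero    n       = ⟦⟧-difference zero n
  ⟦⊖⟧ (suc m) zero    = ⟦⟧-difference (suc m) zero

  −-*-expand : ∀ x y z w → (x - y) * (z - w) ≈ (x * z + y * w) - (x * w + y * z)
  −-*-expand x y z w = begin
    (x - y) * (z - w)                         ≈⟨ distribʳ (z - w) x (- y) ⟩
    x * (z - w) + - y * (z - w)               ≈⟨ +-cong (distribˡ x z (- w)) (distribˡ (- y) z (- w)) ⟩
    (x * z + x * - w) + (- y * z + - y * - w) ≈⟨ +-cong (+-congˡ (sym (-‿distribʳ-* x w)))
                                                        (+-cong (sym (-‿distribˡ-* y z)) (-‿*-involutive y w)) ⟩
    (x * z - x * w) + (- (y * z) + y * w)     ≈⟨ +-congˡ (+-comm _ _) ⟩
    (x * z - x * w) + (y * w - y * z)         ≈⟨ −-+-interchange (x * z) (y * w) (x * w) (y * z) ⟨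
    (x * z + y * w) - (x * w + y * z)         ∎
    where
    -‿*-involutive : ∀ a b → - a * - b ≈ a * b
    -‿*-involutive a b = trans (sym (-‿distribˡ-* a (- b)))
                               (trans (-‿cong (sym (-‿distribʳ-* a b))) (⁻¹-involutive (a * b)))
      where open import Algebra.Properties.Group +-group using (⁻¹-involutive)

  ⟦⟧-homomorphism : ℤ-rawRing AlmostCommutativeRing.-Raw-AlmostCommutative⟶ AlmostCommutativeRing.fromCommutativeRing R
  ⟦⟧-homomorphism = record
    { ⟦_⟧    = ⟦_⟧
    ; +-homo = λ { (a , b) (c , d) → begin
        ⟦ (a ℕ.+ c) ⊖ (b ℕ.+ d) ⟧            ≈⟨ ⟦⊖⟧ (a ℕ.+ c) (b ℕ.+ d) ⟩
        ι (a ℕ.+ c) - ι (b ℕ.+ d)             ≈⟨ +-cong (×-homo-+ 1# a c) (-‿cong (×-homo-+ 1# b d)) ⟩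
        (ι a + ι c) - (ι b + ι d)             ≈⟨ −-+-interchange (ι a) (ι c) (ι b) (ι d) ⟩
        (ι a - ι b) + (ι c - ι d)             ≈⟨ +-cong (⟦⟧-difference a b) (⟦⟧-difference c d) ⟨
        ⟦ a , b ⟧ + ⟦ c , d ⟧                 ∎ }
    ; *-homo = λ { (a , b) (c , d) → begin
        ⟦ (a ℕ.* c ℕ.+ b ℕ.* d) ⊖ (a ℕ.* d ℕ.+ b ℕ.* c) ⟧  ≈⟨ ⟦⊖⟧ (a ℕ.* c ℕ.+ b ℕ.* d) (a ℕ.* d ℕ.+ b ℕ.* c) ⟩
        ι (a ℕ.* c ℕ.+ b ℕ.* d) - ι (a ℕ.* d ℕ.+ b ℕ.* c)  ≈⟨ +-cong (ι-+* a c b d) (-‿cong (ι-+* a d b c)) ⟩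
        (ι a * ι c + ι b * ι d) - (ι a * ι d + ι b * ι c)  ≈⟨ −-*-expand (ι a) (ι b) (ι c) (ι d) ⟨
        (ι a - ι b) * (ι c - ι d)                          ≈⟨ *-cong (⟦⟧-difference a b) (⟦⟧-difference c d) ⟨
        ⟦ a , b ⟧ * ⟦ c , d ⟧                              ∎ }
    ; -‿homo = λ { (a , b) → begin
        ⟦ b , a ⟧      ≈⟨ ⟦⟧-difference b a ⟩
        ι b - ι a      ≈⟨ ⁻¹-anti-homo‿- (ι a) (ι b) ⟨
        - (ι a - ι b)  ≈⟨ -‿cong (⟦⟧-difference a b) ⟨
        - ⟦ a , b ⟧    ∎ }
    ; 0-homo = -‿inverseʳ 0#
    ; 1-homo = refl
    }
    where
    ι-+* : ∀ a c b d → ι (a ℕ.* c ℕ.+ b ℕ.* d) ≈ ι a * ι c + ι b * ι d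
    ι-+* a c b d = trans (×-homo-+ 1# (a ℕ.* c) (b ℕ.* d)) (+-cong (×1-homo-* a c) (×1-homo-* b d))

  _≟ℤ_ : ∀ x y → Maybe (⟦ x ⟧ ≈ ⟦ y ⟧)
  (a , b) ≟ℤ (c , d) with a ℕ.≟ c | b ℕ.≟ d
  ... | yes ≡.refl | yes ≡.refl = just refl
  ... | _          | _          = nothing

  open Algebra.Solver.Ring ℤ-rawRing (AlmostCommutativeRing.fromCommutativeRing R) ⟦⟧-homomorphism _≟ℤ_ public
    using (Polynomial; solve; _:=_; _:+_; _:*_; _:-_; :-_; con)

  :1 : ∀ {n} → Polynomial n
  :1 = con (1 , 0)

module Lifting {c ℓ : Level} (R : CommutativeRing c ℓ) where
  open CommutativeRing R
  open Theory R
  open IntegerCoefficientSolver R using (solve; _:=_; _:+_; _:*_; _:-_; :-_; :1)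
  open import Algebra.Properties.CommutativeSemigroup +-commutativeSemigroup using (interchange)
  open import Relation.Binary.Reasoning.Setoid setoid

  _+ᴵ_ : Ideal → Ideal → Ideal
  I +ᴵ J = record
    { _∋_      = λ x → ∃[ m ] ∃[ n ] (m ∈ I × n ∈ J × x ≈ m + n)
    ; ∋-resp-≈ = λ { x≈y (m , n , m∈I , n∈J , x≈m+n) → m , n , m∈I , n∈J , trans (sym x≈y) x≈m+n }
    ; ∋-0#     = 0# , 0# , ∋-0# I , ∋-0# J , sym (+-identityʳ 0#)
    ; ∋-+      = λ { (m , n , m∈I , n∈J , x≈m+n) (m′ , n′ , m′∈I , n′∈J , y≈m′+n′) →
                     m + m′ , n + n′ , ∋-+ I m∈I m′∈I , ∋-+ J n∈J n′∈J ,
                     trans (+-cong x≈m+n y≈m′+n′) (interchange m n m′ n′) }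
    ; ∋-*      = λ { r (m , n , m∈I , n∈J , x≈m+n) →
                     r * m , r * n , ∋-* I r m∈I , ∋-* J r n∈J , trans (*-congˡ x≈m+n) (distribˡ r m n) }
    }

  ⟨_⟩ : Carrier → Ideal
  ⟨ z ⟩ = record
    { _∋_      = λ x → ∃[ k ] (x ≈ k * z)
    ; ∋-resp-≈ = λ { x≈y (k , x≈kz) → k , trans (sym x≈y) x≈kz }
    ; ∋-0#     = 0# , sym (zeroˡ z)
    ; ∋-+      = λ { (k , x≈kz) (k′ , y≈k′z) → k + k′ , trans (+-cong x≈kz y≈k′z) (sym (distribʳ z k k′)) }
    ; ∋-*      = λ { r (k , x≈kz) → r * k , trans (*-congˡ x≈kz) (sym (*-assoc r k z)) }
    }

  ⊆⊎comaximal : (M : MaximalIdeal) (I : Ideal) → I ⊆ ideal M ⊎ Comaximal I (ideal M)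
  ⊆⊎comaximal M I with proj₂ (isMaximal M) (I +ᴵ ideal M) (λ x x∈M → 0# , x , ∋-0# I , x∈M , sym (+-identityˡ x))
  ... | inj₁ (I+M⊆M , _) = inj₁ λ x x∈I → I+M⊆M x (x , 0# , x∈I , ∋-0# (ideal M) , sym (+-identityʳ x))
  ... | inj₂ (_ , R⊆I+M) with R⊆I+M 1# (lift tt)
  ...   | i , m , i∈I , m∈M , 1≈i+m = inj₂ (i , m , i∈I , m∈M , sym 1≈i+m)

  InvertibleMod : Ideal → Carrier → Set (c ⊔ ℓ)
  InvertibleMod I z = ∃[ w ] ((w * z - 1#) ∈ I)

  invertibleMod-resp-≈ : ∀ I {z z′} → z ≈ z′ → InvertibleMod I z → InvertibleMod I z′
  invertibleMod-resp-≈ I z≈z′ (w , wz-1∈I) = w , ∋-resp-≈ I (+-congʳ (*-congˡ z≈z′)) wz-1∈I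

  invertibleMod-mono : ∀ I J {z} → I ⊆ J → InvertibleMod I z → InvertibleMod J z
  invertibleMod-mono I J I⊆J (w , wz-1∈I) = w , I⊆J _ wz-1∈I

  invertibleMod-+ : ∀ I {z d} → InvertibleMod I z → d ∈ I → InvertibleMod I (z + d)
  invertibleMod-+ I {z} {d} (w , wz-1∈I) d∈I =
    w , ∋-resp-≈ I (solve 3 (λ w z d → (w :* z :- :1) :+ w :* d := w :* (z :+ d) :- :1) refl w z d)
                   (∋-+ I wz-1∈I (∋-* I w d∈I))

  -- The witness comes from expanding (kz - 1)(wz - 1) ∈ I · J.
  invertibleMod-· : ∀ I J {z} → InvertibleMod I z → InvertibleMod J z → InvertibleMod (I · J) z
  invertibleMod-· I J {z} (k , kz-1∈I) (w , wz-1∈J) =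
    k + w - k * w * z ,
    resp (solve 3 (λ k w z → (:- :1) :* ((k :* z :- :1) :* (w :* z :- :1)) := (k :+ w :- k :* w :* z) :* z :- :1) refl k w z)
         (scal (- 1#) (gen kz-1∈I wz-1∈J))

  invertibleMod∧∈⇒1∈ : ∀ I {z} → InvertibleMod I z → z ∈ I → 1# ∈ I
  invertibleMod∧∈⇒1∈ I {z} (w , wz-1∈I) z∈I =
    ∋-resp-≈ I (solve 2 (λ w z → w :* z :+ (:- :1) :* (w :* z :- :1) := :1) refl w z)
               (∋-+ I (∋-* I w z∈I) (∋-* I (- 1#) wz-1∈I))

  comaximal-⟨⟩⇒invertibleMod : ∀ I {z} → Comaximal ⟨ z ⟩ I → InvertibleMod I z
  comaximal-⟨⟩⇒invertibleMod I {z} (i , m , (k , i≈kz) , m∈I , i+m≈1) =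
    k , ∋-resp-≈ I (begin
      - 1# * m                ≈⟨ solve 2 (λ i m → (:- :1) :* m := i :- (i :+ m)) refl (k * z) m ⟩
      k * z - (k * z + m)     ≈⟨ +-congˡ (-‿cong (+-congʳ (sym i≈kz))) ⟩
      k * z - (i + m)         ≈⟨ +-congˡ (-‿cong i+m≈1) ⟩
      k * z - 1#              ∎)
      (∋-* I (- 1#) m∈I)

  ∈⊎invertibleMod : (M : MaximalIdeal) (z : Carrier) → z ∈ ideal M ⊎ InvertibleMod (ideal M) z
  ∈⊎invertibleMod M z = Sum.map (λ ⟨z⟩⊆M → ⟨z⟩⊆M z (1# , sym (*-identityˡ z)))
                                     (comaximal-⟨⟩⇒invertibleMod (ideal M))
                                     (⊆⊎comaximal M ⟨ z ⟩)

  InvertibleShiftMod : Ideal → Carrier → Carrier → Set (c ⊔ ℓ)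
  InvertibleShiftMod I α β = ∃[ τ ] InvertibleMod I (α + τ * β)

  -- Modulo I, α + τβ ≡ 0 and xα + yβ = 1 give (y - xτ)β ≡ 1, so shifting τ by e(y - xτ) with e ≡ 1 yields 1.
  shift-invertibleMod : ∀ I {α β x y τ e m} → x * α + y * β ≈ 1# → (α + τ * β) ∈ I → m ∈ I → e + m ≈ 1# →
                        InvertibleMod I (α + (τ + e * (y - x * τ)) * β)
  shift-invertibleMod I {α} {β} {x} {y} {τ} {e} {m} xα+yβ≈1 z∈I m∈I e+m≈1 =
    1# , ∋-resp-≈ I (begin
      (1# - e * x) * (α + τ * β) + (- (x * α + y * β)) * m
        ≈⟨ solve 7 (λ α β x y τ e m →
             (:1 :- e :* x) :* (α :+ τ :* β) :+ (:- (x :* α :+ y :* β)) :* m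
               := :1 :* (α :+ (τ :+ e :* (y :- x :* τ)) :* β) :- (e :+ m) :* (x :* α :+ y :* β))
             refl α β x y τ e m ⟩
      1# * z′ - (e + m) * (x * α + y * β)
        ≈⟨ +-congˡ (-‿cong (*-cong e+m≈1 xα+yβ≈1)) ⟩
      1# * z′ - 1# * 1#
        ≈⟨ +-congˡ (-‿cong (*-identityˡ 1#)) ⟩
      1# * z′ - 1# ∎)
      (∋-+ I (∋-* I (1# - e * x) z∈I) (∋-* I (- (x * α + y * β)) m∈I))
    where z′ = α + (τ + e * (y - x * τ)) * β

  invertibleShiftMod-maximal· : ∀ {P α β} → Unimodular α β → (M : MaximalIdeal) →
                             InvertibleShiftMod P α β → InvertibleShiftMod (ideal M · P) α β
  invertibleShiftMod-maximal· {P} {α} {β} (x , y , xα+yβ≈1) M (τ , z-inv-P)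
    with ∈⊎invertibleMod M (α + τ * β)
  ... | inj₂ z-inv-M = τ , invertibleMod-· (ideal M) P z-inv-M z-inv-P
  ... | inj₁ z∈M with ⊆⊎comaximal M P
  ...   | inj₁ P⊆M = ⊥-elim (proj₁ (isMaximal M)
                       (invertibleMod∧∈⇒1∈ (ideal M) (invertibleMod-mono P (ideal M) P⊆M z-inv-P) z∈M))
  ...   | inj₂ (e , m , e∈P , m∈M , e+m≈1) =
    τ + e * g , invertibleMod-· (ideal M) P (shift-invertibleMod (ideal M) xα+yβ≈1 z∈M m∈M e+m≈1) z′-inv-P
    where
    g = y - x * τ
    z′-inv-P : InvertibleMod P (α + (τ + e * g) * β)
    z′-inv-P = invertibleMod-resp-≈ P
      (solve 5 (λ α β τ e g → (α :+ τ :* β) :+ (g :* β) :* e := α :+ (τ :+ e :* g) :* β) refl α β τ e g)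
      (invertibleMod-+ P z-inv-P (∋-* P (g * β) e∈P))

  invertibleShiftMod-prodList : ∀ {α β} → Unimodular α β → ∀ Ms → InvertibleShiftMod (prodList Ms) α β
  invertibleShiftMod-prodList αβ-unimodular []       = 0# , 0# , lift tt
  invertibleShiftMod-prodList αβ-unimodular (M ∷ Ms) =
    invertibleShiftMod-maximal· αβ-unimodular M (invertibleShiftMod-prodList αβ-unimodular Ms)

  det-pairing-unimodular : ∀ {a b c d x y u v} → x * a + y * b ≈ 1# → u * c + v * d ≈ 1# →
                           Unimodular (d * a - c * b) (c * x + d * y)
  det-pairing-unimodular {a} {b} {c} {d} {x} {y} {u} {v} xa+yb≈1 uc+vd≈1 =
    v * x - u * y , u * a + v * b , (begin
      (v * x - u * y) * (d * a - c * b) + (u * a + v * b) * (c * x + d * y)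
        ≈⟨ solve 8 (λ a b c d x y u v →
             (v :* x :- u :* y) :* (d :* a :- c :* b) :+ (u :* a :+ v :* b) :* (c :* x :+ d :* y)
               := (u :* c :+ v :* d) :* (x :* a :+ y :* b)) refl a b c d x y u v ⟩
      (u * c + v * d) * (x * a + y * b) ≈⟨ *-cong uc+vd≈1 xa+yb≈1 ⟩
      1# * 1#                           ≈⟨ *-identityˡ 1# ⟩
      1#                                ∎)

  completion-inSL2 : ∀ {a b x y} → x * a + y * b ≈ 1# → ∀ q r →
                     InSL2 (a - q * y) (b + q * x) (r * a - (1# + r * q) * y) (r * b + (1# + r * q) * x)
  completion-inSL2 {a} {b} {x} {y} xa+yb≈1 q r = trans
    (solve 6 (λ a b x y q r →
       (a :- q :* y) :* (r :* b :+ (:1 :+ r :* q) :* x) :- (b :+ q :* x) :* (r :* a :- (:1 :+ r :* q) :* y)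
         := x :* a :+ y :* b) refl a b x y q r)
    xa+yb≈1

  firstRow-equiv : ∀ I {a b x y q} → q ∈ I → PF-equiv I (a - q * y , b + q * x) (a , b)
  firstRow-equiv I {a} {b} {x} {y} {q} q∈I = ∋-resp-≈ I
    (solve 5 (λ a b x y q → (:- (x :* a :+ y :* b)) :* q := (a :- q :* y) :* b :- (b :+ q :* x) :* a)
       refl a b x y q)
    (∋-* I (- (x * a + y * b)) q∈I)

  secondRow-equiv : ∀ J {a b c d x y q r} → (r * (d * a - c * b) - (1# + r * q) * (c * x + d * y)) ∈ J →
                    PF-equiv J (r * a - (1# + r * q) * y , r * b + (1# + r * q) * x) (c , d)
  secondRow-equiv J {a} {b} {c} {d} {x} {y} {q} {r} = ∋-resp-≈ J
    (solve 8 (λ a b c d x y q r →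
       r :* (d :* a :- c :* b) :- (:1 :+ r :* q) :* (c :* x :+ d :* y)
         := (r :* a :- (:1 :+ r :* q) :* y) :* d :- (r :* b :+ (:1 :+ r :* q) :* x) :* c)
       refl a b c d x y q r)

  -- With q = -τi and i ≡ 1 mod J, the condition of secondRow-equiv reads γ(w(δ + τγ) - 1) ≡ 0 mod J.
  secondRow-condition : ∀ J {δ γ τ w i} → (w * (δ + τ * γ) - 1#) ∈ J → (1# - i) ∈ J →
                        (γ * w * δ - (1# + γ * w * (- τ * i)) * γ) ∈ J
  secondRow-condition J {δ} {γ} {τ} {w} {i} unit∈J 1-i∈J = ∋-resp-≈ J
    (solve 5 (λ δ γ τ w i →
       γ :* (w :* (δ :+ τ :* γ) :- :1) :+ (:- (γ :* w :* τ :* γ)) :* (:1 :- i)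
         := γ :* w :* δ :- (:1 :+ γ :* w :* (:- τ :* i)) :* γ)
       refl δ γ τ w i)
    (∋-+ J (∋-* J γ unit∈J) (∋-* J (- (γ * w * τ * γ)) 1-i∈J))

  +≈1⇒≈1- : ∀ {i j} → i + j ≈ 1# → j ≈ 1# - i
  +≈1⇒≈1- {i} {j} i+j≈1 = begin
    j              ≈⟨ solve 2 (λ i j → j := (i :+ j) :- i) refl i j ⟩
    (i + j) - i    ≈⟨ +-congʳ i+j≈1 ⟩
    1# - i         ∎

mainTheorem12 : ∀ {c ℓ : Level} (R : CommutativeRing c ℓ) →
    let open Theory R in
    IsDedekindType → (I J : Ideal) → InMR I → InMR J → Comaximal I J →
    ∀ (a b c' d : CommutativeRing.Carrier R) → Unimodular a b → Unimodular c' d →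
    ∃[ p ] ∃[ q ] ∃[ r ] ∃[ s ]
      (InSL2 p q r s × PF-equiv I (p , q) (a , b) × PF-equiv J (r , s) (c' , d))
mainTheorem12 R _ I J _ (Ms , _ , ∏Ms⊆J) (i , j , i∈I , j∈J , i+j≈1) a b c d (x , y , xa+yb≈1) (u , v , uc+vd≈1) =
  let τ , w , unit∈∏Ms = invertibleShiftMod-prodList (det-pairing-unimodular xa+yb≈1 uc+vd≈1) Ms
      γ = c * x + d * y
      q = - τ * i
      r = γ * w
  in a - q * y , b + q * x , r * a - (1# + r * q) * y , r * b + (1# + r * q) * x ,
     completion-inSL2 xa+yb≈1 q r ,
     firstRow-equiv I (∋-* I (- τ) i∈I) ,
     secondRow-equiv J (secondRow-condition J (∏Ms⊆J _ unit∈∏Ms) (∋-resp-≈ J (+≈1⇒≈1- i+j≈1) j∈J))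
  where open CommutativeRing R
        open Theory R
        open Lifting R
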